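{- Let $G(x,y)=\sum_{T}\frac{x^{|\mathrm{LV}(T)|}\,y^{|\mathrm{RV}(T)|}}{|\mathrm{LV}(T)|!\,|\mathrm{RV}(T)|!}$, where the sum runs over all non-empty non-ambiguous trees $T$, and let $L(x,y)=x+y+\int_0^x\!\int_0^y G$. Then, as formal power series, $$L = x+y+\int_0^x\!\!\int_0^y \partial_x L\cdot \partial_y L \qquad\text{and}\qquad G=\Big(1+\int_0^x G\Big)\cdot\Big(1+\int_0^y G\Big),$$ where $\int_0^x$ (resp. $\int_0^y$) denotes formal integration with respect to $x$ (resp. $y$) with zero constant term.
   Context: A binary tree is a rooted tree in which each vertex has either no child, a left child, a right child, or both. For a binary tree $B$, $\mathrm{LV}(B)$ (resp. $\mathrm{RV}(B)$) denotes the set of vertices that are left children (resp. right children); the root belongs to neither. A non-ambiguous tree (NAT) is a non-empty binary tree $B$ together with a labelling of its left children by $1,\dots,|\mathrm{LV}(B)|$ (each label used exactly once) and of its right children by $1,\dots,|\mathrm{RV}(B)|$ (each label used exactly once), such that whenever $U$ and $V$ are both left children (resp. both right children) and $U$ is a proper ancestor of $V$, the label of $U$ is strictly greater than the label of $V$. For a NAT $T$ we write $\mathrm{LV}(T),\mathrm{RV}(T)$ for the sets of left/right children of its underlying tree. -}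

module Defs where

open import Data.Nat using (ℕ; zero; suc; _<_; _!)
open import Data.Nat.Properties using (≤-decTotalOrder; _!*_!≢0)
open import Data.Integer using (+_)
open import Data.Rational using (ℚ; _/_; _+_; _*_; 0ℚ; 1ℚ)
open import Data.List using (List; []; _∷_; _++_; map; upTo)
open import Data.List.Relation.Unary.All using (All)
open import Data.Maybe using (Maybe; just; nothing)
open import Data.Product using (Σ; _×_; _,_)
open import Data.Unit using (⊤)
open import Relation.Binary.PropositionalEquality using (_≡_)
open import Data.List.Sort ≤-decTotalOrder using (sort)

-- A non-empty binary tree whose left/right children carry a natural-number
-- label: `node l r` is a vertex; `l = just (k , c)` means it has a left child
-- (root of subtree c) carrying label k; similarly for r and the right child.
-- The root itself carries no label.
data LTree : Set where
  node : Maybe (ℕ × LTree) → Maybe (ℕ × LTree) → LTree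

mutual
  leftLabels : LTree → List ℕ
  leftLabels (node l r) = leftLabelsL l ++ leftLabelsR r

  leftLabelsL : Maybe (ℕ × LTree) → List ℕ
  leftLabelsL nothing = []
  leftLabelsL (just (k , c)) = k ∷ leftLabels c

  leftLabelsR : Maybe (ℕ × LTree) → List ℕ
  leftLabelsR nothing = []
  leftLabelsR (just (k , c)) = leftLabels c

mutual
  rightLabels : LTree → List ℕ
  rightLabels (node l r) = rightLabelsL l ++ rightLabelsR r

  rightLabelsL : Maybe (ℕ × LTree) → List ℕ
  rightLabelsL nothing = []
  rightLabelsL (just (k , c)) = rightLabels c

  rightLabelsR : Maybe (ℕ × LTree) → List ℕ
  rightLabelsR nothing = []
  rightLabelsR (just (k , c)) = k ∷ rightLabels c

mutual
  Decreasing : LTree → Set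
  Decreasing (node l r) = DecL l × DecR r

  DecL : Maybe (ℕ × LTree) → Set
  DecL nothing = ⊤
  DecL (just (k , c)) = All (_< k) (leftLabels c) × Decreasing c

  DecR : Maybe (ℕ × LTree) → Set
  DecR nothing = ⊤
  DecR (just (k , c)) = All (_< k) (rightLabels c) × Decreasing c

oneTo : ℕ → List ℕ
oneTo m = map suc (upTo m)

-- Non-ambiguous trees with exactly m left children and n right children:
-- the left labels are exactly 1..m, each used once (i.e. the sorted list
-- of left labels is 1..m), the right labels are exactly 1..n, and the
-- ancestor condition holds.  (All components are propositions.)
NAT : ℕ → ℕ → Set
NAT m n = Σ LTree λ t →
  (sort (leftLabels t) ≡ oneTo m) × (sort (rightLabels t) ≡ oneTo n) × Decreasing t

-- Formal power series in x, y over ℚ, as coefficient arrays: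
-- F m n is the coefficient of x^m y^n.

PS : Set
PS = ℕ → ℕ → ℚ

sumTo : ℕ → (ℕ → ℚ) → ℚ
sumTo zero f = f zero
sumTo (suc n) f = sumTo n f + f (suc n)

fromℕℚ : ℕ → ℚ
fromℕℚ k = + k / 1

_⊕_ : PS → PS → PS
(F ⊕ H) m n = F m n + H m n
infixl 6 _⊕_

open import Data.Nat using (_∸_)

_⊗_ : PS → PS → PS
(F ⊗ H) m n = sumTo m λ i → sumTo n λ j → F i j * H (m ∸ i) (n ∸ j)
infixl 7 _⊗_

one : PS
one zero zero = 1ℚ
one _ _ = 0ℚ

X : PS
X (suc zero) zero = 1ℚ
X _ _ = 0ℚ

Y : PS
Y zero (suc zero) = 1ℚ
Y _ _ = 0ℚ

∫x : PS → PS
∫x F zero n = 0ℚ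
∫x F (suc m) n = F m n * (+ 1 / suc m)

∫y : PS → PS
∫y F m zero = 0ℚ
∫y F m (suc n) = F m n * (+ 1 / suc n)

∂x : PS → PS
∂x F m n = fromℕℚ (suc m) * F (suc m) n

∂y : PS → PS
∂y F m n = fromℕℚ (suc n) * F m (suc n)

-- Given the counting function a m n = #NATs with m left and n right children,
-- G = Σ a(m,n) x^m y^n / (m! n!)
Gser : (ℕ → ℕ → ℕ) → PS
Gser a m n = _/_ (+ a m n) (m ! Data.Nat.* n !) {{m !* n !≢0}}

Lser : (ℕ → ℕ → ℕ) → PS
Lser a = X ⊕ Y ⊕ ∫x (∫y (Gser a))

-- Since labels decrease
-- along left (resp. right) chains, a left branch carrying i left and j right labels is either empty
-- (i = j = 0) or a left child labelled by its largest left label above an arbitrary tree with i - 1 left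
-- and j right children; this is counted by the coefficients of 1 + ∫x G, and symmetrically right
-- branches by 1 + ∫y G.  Choosing which labels go to which branch is a binomial convolution, so
-- G = (1 + ∫x G)(1 + ∫y G), the exponential generating function of a labelled product.  For L this is
-- the same identity, because ∂x L = 1 + ∫y G and ∂y L = 1 + ∫x G.

module Submission where

open import Defs
open import Algebra.Bundles using (CommutativeMonoid)
open import Axiom.UniquenessOfIdentityProofs using (module Decidable⇒UIP)
open import Data.Bool using (Bool; true; false)
open import Data.Empty using (⊥; ⊥-elim)
open import Data.Fin using (Fin) renaming (zero to fzero; suc to fsuc)
open import Data.Fin.Permutation using (↔⇒≡)
open import Data.Fin.Properties using (+↔⊎; *↔×)
open import Data.Integer using (+_)
import Data.Integer as ℤ
open import Data.Integer.Properties using (pos-*; pos-+)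
open import Data.List using (List; []; _∷_; _++_; length; applyUpTo; applyDownFrom)
open import Data.List.Membership.Propositional using (_∈_)
open import Data.List.Membership.Propositional.Properties using (∈-∃++; ∈-++⁻)
open import Data.List.Properties using (++-conicalˡ; ++-conicalʳ; ≡-dec; map-applyUpTo; applyUpTo-∷ʳ; length-applyDownFrom)
open import Data.List.Relation.Binary.Permutation.Propositional using (_↭_; ↭-refl; ↭-sym; ↭-trans; prep; ↭⇒↭ₛ)
open import Data.List.Relation.Binary.Permutation.Propositional.Properties
  using (↭-empty-inv; ¬x∷xs↭[]; drop-∷; shift; ++⁺; ++⁺ˡ; ++⁺ʳ; ∈-resp-↭; All-resp-↭; ∷↭∷ʳ)
open import Data.List.Relation.Binary.Pointwise using (Pointwise-≡⇒≡)
open import Data.List.Relation.Unary.All as All using (All; []; _∷_)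
open import Data.List.Relation.Unary.AllPairs using (AllPairs; []; _∷_)
open import Data.List.Relation.Unary.Any using (here; there)
open import Data.List.Relation.Unary.Linked using ([]; [-]; _∷_)
open import Data.List.Relation.Unary.Sorted.TotalOrder using (Sorted)
open import Data.List.Relation.Unary.Sorted.TotalOrder.Properties using (↗↭↗⇒≋)
open import Data.Maybe using (Maybe; just; nothing)
open import Data.Nat using (ℕ; zero; suc; _+_; _*_; _∸_; _≤_; _<_; _>_; z≤n; s≤s; _!; NonZero)
open import Data.Nat.Combinatorics using (_C_; nCk≡n!/k![n-k]!; k![n∸k]!∣n!; nCk+nC[k+1]≡[n+1]C[k+1]; k>n⇒nCk≡0)
open import Data.Nat.DivMod using (m/n*n≡m)
open import Data.Nat.Properties
  using (≤-decTotalOrder; ≤-totalOrder; _≟_; <-irrelevant; <-irrefl; <-asym; ≤-refl; ≤-trans; ≤-pred;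
         m≤n⇒m≤1+n; n≤1+n; n<1+n; m≤m+n; m≤n+m; +-mono-≤; +-suc; +-∸-assoc; m∸[m∸n]≡n;
         +-identityʳ; *-identityˡ; +-assoc; *-distribʳ-+; *-distribˡ-+; +-commutativeSemigroup; _!*_!≢0; m*n≢0)
open import Data.Nat.Tactic.RingSolver using (solve-∀)
open import Data.List.Membership.DecPropositional _≟_ using (_∈?_)
open import Data.List.Sort ≤-decTotalOrder using (sort; sort-↭; sort-↗)
open import Data.Product using (Σ; _×_; _,_; proj₁; proj₂; ∃)
open import Data.Product.Function.NonDependent.Propositional using (_×-↔_)
open import Data.Rational using (ℚ; _/_; 1ℚ; toℚᵘ) renaming (_+_ to _+ℚ_; _*_ to _*ℚ_)
open import Data.Rational.Properties as ℚ using (toℚᵘ-injective; toℚᵘ-fromℚᵘ; toℚᵘ-homo-+; toℚᵘ-homo-*; 0/n≡0)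
open import Data.Rational.Unnormalised using (mkℚᵘ; *≡*) renaming (_≃_ to _≃ᵘ_)
import Data.Rational.Unnormalised.Properties as ℚᵘ
open import Data.Sum using (_⊎_; inj₁; inj₂)
open import Data.Sum.Function.Propositional using (_⊎-↔_)
open import Data.Unit using (tt)
open import Data.Vec using (Vec; []; _∷_)
open import Function using (_∘_; _∘′_)
open import Function.Bundles using (_↔_; _⇔_; mk⇔; mk↔ₛ′)
open import Function.Properties.Inverse using (↔-sym; ↔-trans)
open import Relation.Nullary using (Irrelevant; does; yes; no)
open import Relation.Nullary.Decidable using (dec-true; dec-false; does-⇔)
open import Relation.Binary.PropositionalEquality
open import Algebra.Properties.CommutativeSemigroup +-commutativeSemigroup
  using () renaming (interchange to +-interchange; x∙yz≈y∙xz to x+[y+z]≡y+[x+z])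
open import Algebra.Properties.CommutativeSemigroup (CommutativeMonoid.commutativeSemigroup ℚ.*-1-commutativeMonoid)
  using () renaming (x∙yz≈y∙xz to x*[y*z]≡y*[x*z])
open ≡-Reasoning

-- Sorted label lists and subsets

sorted-↭⇒≡ : ∀ {xs ys} → Sorted ≤-totalOrder xs → Sorted ≤-totalOrder ys → xs ↭ ys → xs ≡ ys
sorted-↭⇒≡ xs↗ ys↗ xs↭ys = Pointwise-≡⇒≡ (↗↭↗⇒≋ ≤-totalOrder xs↗ ys↗ (↭⇒↭ₛ xs↭ys))

↭⇒sort-≡ : ∀ {xs ys} → xs ↭ ys → sort xs ≡ sort ys
↭⇒sort-≡ {xs} {ys} xs↭ys =
  sorted-↭⇒≡ (sort-↗ xs) (sort-↗ ys) (↭-trans (sort-↭ xs) (↭-trans xs↭ys (↭-sym (sort-↭ ys))))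

sort-≡⇒↭ : ∀ {xs ys} → sort xs ≡ sort ys → xs ↭ ys
sort-≡⇒↭ {xs} {ys} e = ↭-trans (↭-sym (sort-↭ xs)) (subst (_↭ ys) (sym e) (sort-↭ ys))

List-≡-irrelevant : {xs ys : List ℕ} → Irrelevant (xs ≡ ys)
List-≡-irrelevant = Decidable⇒UIP.≡-irrelevant (≡-dec _≟_)

∈⇒↭∷ : ∀ {x : ℕ} {xs} → x ∈ xs → ∃ λ xs′ → xs ↭ x ∷ xs′
∈⇒↭∷ x∈xs with ∈-∃++ x∈xs
... | as , bs , refl = as ++ bs , shift _ as bs

↭∷⇒∈⇔∈ : ∀ {x z : ℕ} {xs xs′} → xs ↭ x ∷ xs′ → z ≢ x → z ∈ xs ⇔ z ∈ xs′
↭∷⇒∈⇔∈ {x} {z} {xs} {xs′} xs↭ z≢x = mk⇔ (drop-head ∘ ∈-resp-↭ xs↭) (∈-resp-↭ (↭-sym xs↭) ∘ there)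
  where
    drop-head : z ∈ x ∷ xs′ → z ∈ xs′
    drop-head (here z≡x) = ⊥-elim (z≢x z≡x)
    drop-head (there z∈xs′) = z∈xs′

↭-head-max : ∀ {k k′ zs A} → k′ ∷ zs ↭ k ∷ A → All (_< k′) zs → All (_< k) A → k′ ≡ k × zs ↭ A
↭-head-max p zs<k′ A<k with ∈-resp-↭ p (here refl)
... | here k′≡k = k′≡k , drop-∷ (subst (λ u → u ∷ _ ↭ _) k′≡k p)
... | there k′∈A with ∈-resp-↭ (↭-sym p) (here refl)
...   | here k≡k′ = ⊥-elim (<-irrefl (sym k≡k′) (All.lookup A<k k′∈A))
...   | there k∈zs = ⊥-elim (<-asym (All.lookup A<k k′∈A) (All.lookup zs<k′ k∈zs))

Descending : List ℕ → Set
Descending = AllPairs _>_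

below-head⇒≢ : ∀ {x z D} → All (x >_) D → z ∈ D → z ≢ x
below-head⇒≢ x>D z∈D refl = <-irrefl refl (All.lookup x>D z∈D)

membership : List ℕ → (D : List ℕ) → Vec Bool (length D)
membership xs [] = []
membership xs (x ∷ D) = does (x ∈? xs) ∷ membership xs D

selected unselected : (D : List ℕ) → Vec Bool (length D) → List ℕ
selected [] [] = []
selected (x ∷ D) (true ∷ v) = x ∷ selected D v
selected (x ∷ D) (false ∷ v) = selected D v
unselected [] [] = []
unselected (x ∷ D) (true ∷ v) = unselected D v
unselected (x ∷ D) (false ∷ v) = x ∷ unselected D v

selected-⊆ : ∀ D v {z} → z ∈ selected D v → z ∈ D
selected-⊆ [] [] ()
selected-⊆ (x ∷ D) (true ∷ v) (here z≡x) = here z≡x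
selected-⊆ (x ∷ D) (true ∷ v) (there z∈) = there (selected-⊆ D v z∈)
selected-⊆ (x ∷ D) (false ∷ v) z∈ = there (selected-⊆ D v z∈)

All-selected : ∀ {P : ℕ → Set} D v → All P D → All P (selected D v)
All-selected [] [] [] = []
All-selected (x ∷ D) (true ∷ v) (px ∷ pD) = px ∷ All-selected D v pD
All-selected (x ∷ D) (false ∷ v) (px ∷ pD) = All-selected D v pD

All-unselected : ∀ {P : ℕ → Set} D v → All P D → All P (unselected D v)
All-unselected [] [] [] = []
All-unselected (x ∷ D) (true ∷ v) (px ∷ pD) = All-unselected D v pD
All-unselected (x ∷ D) (false ∷ v) (px ∷ pD) = px ∷ All-unselected D v pD

Descending-selected : ∀ D v → Descending D → Descending (selected D v)
Descending-selected [] [] [] = []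
Descending-selected (x ∷ D) (true ∷ v) (x>D ∷ D↘) = All-selected D v x>D ∷ Descending-selected D v D↘
Descending-selected (x ∷ D) (false ∷ v) (x>D ∷ D↘) = Descending-selected D v D↘

Descending-unselected : ∀ D v → Descending D → Descending (unselected D v)
Descending-unselected [] [] [] = []
Descending-unselected (x ∷ D) (true ∷ v) (x>D ∷ D↘) = Descending-unselected D v D↘
Descending-unselected (x ∷ D) (false ∷ v) (x>D ∷ D↘) = All-unselected D v x>D ∷ Descending-unselected D v D↘

length-selected≤ : ∀ D v → length (selected D v) ≤ length D
length-selected≤ [] [] = z≤n
length-selected≤ (x ∷ D) (true ∷ v) = s≤s (length-selected≤ D v)
length-selected≤ (x ∷ D) (false ∷ v) = m≤n⇒m≤1+n (length-selected≤ D v)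

length-unselected≤ : ∀ D v → length (unselected D v) ≤ length D
length-unselected≤ [] [] = z≤n
length-unselected≤ (x ∷ D) (true ∷ v) = m≤n⇒m≤1+n (length-unselected≤ D v)
length-unselected≤ (x ∷ D) (false ∷ v) = s≤s (length-unselected≤ D v)

selected++unselected↭ : ∀ D v → selected D v ++ unselected D v ↭ D
selected++unselected↭ [] [] = ↭-refl
selected++unselected↭ (x ∷ D) (true ∷ v) = prep x (selected++unselected↭ D v)
selected++unselected↭ (x ∷ D) (false ∷ v) =
  ↭-trans (shift x (selected D v) (unselected D v)) (prep x (selected++unselected↭ D v))

membership-cong : ∀ {xs ys} D → (∀ {z} → z ∈ D → z ∈ xs ⇔ z ∈ ys) → membership xs D ≡ membership ys D
membership-cong [] _ = refl
membership-cong (x ∷ D) xs⇔ys =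
  cong₂ _∷_ (does-⇔ (xs⇔ys (here refl)) (x ∈? _) (x ∈? _)) (membership-cong D (xs⇔ys ∘ there))

membership-selected : ∀ D v → Descending D → membership (selected D v) D ≡ v
membership-selected [] [] [] = refl
membership-selected (x ∷ D) (true ∷ v) (x>D ∷ D↘) = cong₂ _∷_ (dec-true (x ∈? x ∷ selected D v) (here refl))
  (trans (membership-cong D λ z∈D → ↭∷⇒∈⇔∈ ↭-refl (below-head⇒≢ x>D z∈D)) (membership-selected D v D↘))
membership-selected (x ∷ D) (false ∷ v) (x>D ∷ D↘) =
  cong₂ _∷_ (dec-false (x ∈? _) λ x∈ → below-head⇒≢ x>D (selected-⊆ D v x∈) refl) (membership-selected D v D↘)

↭selected⇒membership : ∀ {xs} D v → Descending D → xs ↭ selected D v → membership xs D ≡ v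
↭selected⇒membership D v D↘ xs↭ =
  trans (membership-cong D λ _ → mk⇔ (∈-resp-↭ xs↭) (∈-resp-↭ (↭-sym xs↭))) (membership-selected D v D↘)

split-↭ : ∀ {xs ys} D → Descending D → xs ++ ys ↭ D →
  xs ↭ selected D (membership xs D) × ys ↭ unselected D (membership xs D)
split-↭ {xs} {ys} [] [] p with ++-conicalˡ xs ys (↭-empty-inv p) | ++-conicalʳ xs ys (↭-empty-inv p)
... | refl | refl = ↭-refl , ↭-refl
split-↭ {xs} {ys} (x ∷ D) (x>D ∷ D↘) p with x ∈? xs
... | yes x∈xs =
  let xs′ , xs↭ = ∈⇒↭∷ x∈xs
      xs′↭ , ys↭ = split-↭ D D↘ (drop-∷ (↭-trans (↭-sym (++⁺ʳ ys xs↭)) p))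
      same = membership-cong D λ z∈D → ↭∷⇒∈⇔∈ xs↭ (below-head⇒≢ x>D z∈D)
  in ↭-trans xs↭ (prep x (subst (λ v → xs′ ↭ selected D v) (sym same) xs′↭))
   , subst (λ v → ys ↭ unselected D v) (sym same) ys↭
... | no x∉xs =
  let ys′ , ys↭ = ∈⇒↭∷ (x∈ys (∈-++⁻ xs (∈-resp-↭ (↭-sym p) (here refl))))
      xs↭ , ys′↭ = split-↭ D D↘ (drop-∷ (↭-trans (↭-sym (↭-trans (++⁺ˡ xs ys↭) (shift x xs ys′))) p))
  in xs↭ , ↭-trans ys↭ (prep x ys′↭)
  where
    x∈ys : x ∈ xs ⊎ x ∈ ys → x ∈ ys
    x∈ys (inj₁ x∈xs) = ⊥-elim (x∉xs x∈xs)
    x∈ys (inj₂ x∈ys) = x∈ys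

-- Counting non-ambiguous trees

Σ-≡-irrelevant : ∀ {A : Set} {P : A → Set} → (∀ x → Irrelevant (P x)) →
  ∀ {x y} {p : P x} {q : P y} → x ≡ y → _≡_ {A = Σ A P} (x , p) (y , q)
Σ-≡-irrelevant P-irr {x} {p = p} {q} refl = cong (x ,_) (P-irr x p q)

×-irrelevant : ∀ {A B : Set} → Irrelevant A → Irrelevant B → Irrelevant (A × B)
×-irrelevant A-irr B-irr (a , b) (a′ , b′) = cong₂ _,_ (A-irr a a′) (B-irr b b′)

mutual
  Decreasing-irrelevant : ∀ t → Irrelevant (Decreasing t)
  Decreasing-irrelevant (node l r) = ×-irrelevant (DecL-irrelevant l) (DecR-irrelevant r)

  DecL-irrelevant : ∀ l → Irrelevant (DecL l)
  DecL-irrelevant nothing tt tt = refl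
  DecL-irrelevant (just (k , c)) = ×-irrelevant (All.irrelevant <-irrelevant) (Decreasing-irrelevant c)

  DecR-irrelevant : ∀ r → Irrelevant (DecR r)
  DecR-irrelevant nothing tt tt = refl
  DecR-irrelevant (just (k , c)) = ×-irrelevant (All.irrelevant <-irrelevant) (Decreasing-irrelevant c)

-- NAT m n is Trees (oneTo m) (oneTo n); the root branches are indexed by unsorted label lists.
LabelledBy : List ℕ → List ℕ → LTree → Set
LabelledBy S T t = (sort (leftLabels t) ≡ S) × (sort (rightLabels t) ≡ T) × Decreasing t

Trees : List ℕ → List ℕ → Set
Trees S T = Σ LTree (LabelledBy S T)

LeftBranchLabelledBy RightBranchLabelledBy : List ℕ → List ℕ → Maybe (ℕ × LTree) → Set
LeftBranchLabelledBy A B l = (sort (leftLabelsL l) ≡ sort A) × (sort (rightLabelsL l) ≡ sort B) × DecL l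
RightBranchLabelledBy A B r = (sort (leftLabelsR r) ≡ sort A) × (sort (rightLabelsR r) ≡ sort B) × DecR r

LeftBranches RightBranches : List ℕ → List ℕ → Set
LeftBranches A B = Σ (Maybe (ℕ × LTree)) (LeftBranchLabelledBy A B)
RightBranches A B = Σ (Maybe (ℕ × LTree)) (RightBranchLabelledBy A B)

LabelledBy-irrelevant : ∀ {S T} t → Irrelevant (LabelledBy S T t)
LabelledBy-irrelevant t = ×-irrelevant List-≡-irrelevant (×-irrelevant List-≡-irrelevant (Decreasing-irrelevant t))

LeftBranchLabelledBy-irrelevant : ∀ {A B} l → Irrelevant (LeftBranchLabelledBy A B l)
LeftBranchLabelledBy-irrelevant l = ×-irrelevant List-≡-irrelevant (×-irrelevant List-≡-irrelevant (DecL-irrelevant l))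

RightBranchLabelledBy-irrelevant : ∀ {A B} r → Irrelevant (RightBranchLabelledBy A B r)
RightBranchLabelledBy-irrelevant r = ×-irrelevant List-≡-irrelevant (×-irrelevant List-≡-irrelevant (DecR-irrelevant r))

-- A tree is its pair of root branches together with the choice of which labels go to the left one.
Splitting : List ℕ → List ℕ → Set
Splitting D E = Σ (Vec Bool (length D)) λ v → Σ (Vec Bool (length E)) λ w →
  LeftBranches (selected D v) (selected E w) × RightBranches (unselected D v) (unselected E w)

Trees↔Splitting : ∀ D E → Descending D → Descending E → Trees (sort D) (sort E) ↔ Splitting D E
Trees↔Splitting D E D↘ E↘ = mk↔ₛ′ to from to∘from from∘to
  where
    to : Trees (sort D) (sort E) → Splitting D E
    to (node l r , sortL , sortR , (decL , decR)) =
      let l₁ , r₁ = split-↭ D D↘ (sort-≡⇒↭ sortL)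
          l₂ , r₂ = split-↭ E E↘ (sort-≡⇒↭ sortR)
      in membership (leftLabelsL l) D , membership (rightLabelsL l) E
       , (l , ↭⇒sort-≡ l₁ , ↭⇒sort-≡ l₂ , decL) , (r , ↭⇒sort-≡ r₁ , ↭⇒sort-≡ r₂ , decR)

    from : Splitting D E → Trees (sort D) (sort E)
    from (v , w , (l , l₁ , l₂ , decL) , (r , r₁ , r₂ , decR)) =
      node l r
      , ↭⇒sort-≡ (↭-trans (++⁺ (sort-≡⇒↭ l₁) (sort-≡⇒↭ r₁)) (selected++unselected↭ D v))
      , ↭⇒sort-≡ (↭-trans (++⁺ (sort-≡⇒↭ l₂) (sort-≡⇒↭ r₂)) (selected++unselected↭ E w))
      , (decL , decR)

    to∘from : ∀ s → to (from s) ≡ s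
    to∘from (v , w , (l , l₁ , l₂ , _) , (r , _)) =
      same-branches (↭selected⇒membership D v D↘ (sort-≡⇒↭ l₁)) (↭selected⇒membership E w E↘ (sort-≡⇒↭ l₂))
      where
        same-branches : ∀ {v′ w′ p p′ q q′} → v′ ≡ v → w′ ≡ w →
          _≡_ {A = Splitting D E} (v′ , w′ , (l , p′) , (r , q′)) (v , w , (l , p) , (r , q))
        same-branches refl refl =
          cong₂ (λ p q → v , w , (l , p) , (r , q)) (LeftBranchLabelledBy-irrelevant l _ _) (RightBranchLabelledBy-irrelevant r _ _)

    from∘to : ∀ t → from (to t) ≡ t
    from∘to (node l r , _) = Σ-≡-irrelevant LabelledBy-irrelevant refl

-- subsetSum m g sums g |S| (m - |S|) over the subsets S of an m-element set.
subsetSum : ℕ → (ℕ → ℕ → ℕ) → ℕ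
subsetSum zero g = g 0 0
subsetSum (suc m) g = subsetSum m (λ i k → g (suc i) k) + subsetSum m (λ i k → g i (suc k))

subsetSum-cong : ∀ m {g h} → (∀ i k → i + k ≡ m → g i k ≡ h i k) → subsetSum m g ≡ subsetSum m h
subsetSum-cong zero g≡h = g≡h 0 0 refl
subsetSum-cong (suc m) g≡h = cong₂ _+_
  (subsetSum-cong m λ i k e → g≡h (suc i) k (cong suc e))
  (subsetSum-cong m λ i k e → g≡h i (suc k) (trans (+-suc i k) (cong suc e)))

Σ-subsets↔Fin : ∀ D (F : Vec Bool (length D) → Set) g →
  (∀ v → F v ↔ Fin (g (length (selected D v)) (length (unselected D v)))) → Σ _ F ↔ Fin (subsetSum (length D) g)
Σ-subsets↔Fin [] F g F↔ = ↔-trans Σ-empty (F↔ [])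
  where
    Σ-empty : Σ _ F ↔ F []
    Σ-empty = mk↔ₛ′ (λ { ([] , x) → x }) ([] ,_) (λ _ → refl) (λ { ([] , _) → refl })
Σ-subsets↔Fin (_ ∷ D) F g F↔ = ↔-trans Σ-head
  (↔-trans (Σ-subsets↔Fin D _ _ (F↔ ∘ (true ∷_)) ⊎-↔ Σ-subsets↔Fin D _ _ (F↔ ∘ (false ∷_))) (↔-sym +↔⊎))
  where
    Σ-head : Σ _ F ↔ (Σ _ (F ∘ (true ∷_)) ⊎ Σ _ (F ∘ (false ∷_)))
    Σ-head = mk↔ₛ′
      (λ { (true ∷ v , x) → inj₁ (v , x) ; (false ∷ v , x) → inj₂ (v , x) })
      (λ { (inj₁ (v , x)) → true ∷ v , x ; (inj₂ (v , x)) → false ∷ v , x })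
      (λ { (inj₁ _) → refl ; (inj₂ _) → refl })
      (λ { (true ∷ _ , _) → refl ; (false ∷ _ , _) → refl })

labelledProduct : (ℕ → ℕ → ℕ) → (ℕ → ℕ → ℕ) → ℕ → ℕ → ℕ
labelledProduct P Q m n = subsetSum m λ i k → subsetSum n λ j l → P i j * Q k l

leftBranch rightBranch : (ℕ → ℕ → ℕ) → ℕ → ℕ → ℕ
leftBranch c (suc i) j = c i j
leftBranch c zero zero = 1
leftBranch c zero (suc j) = 0
rightBranch c i (suc j) = c i j
rightBranch c zero zero = 1
rightBranch c (suc i) zero = 0

leftBranch-cong : ∀ f {c c′} → (∀ i j → i + j < f → c i j ≡ c′ i j) →
  ∀ i j → i + j ≤ f → leftBranch c i j ≡ leftBranch c′ i j
leftBranch-cong f c≡c′ (suc i) j size = c≡c′ i j size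
leftBranch-cong f c≡c′ zero zero _ = refl
leftBranch-cong f c≡c′ zero (suc j) _ = refl

rightBranch-cong : ∀ f {c c′} → (∀ i j → i + j < f → c i j ≡ c′ i j) →
  ∀ i j → i + j ≤ f → rightBranch c i j ≡ rightBranch c′ i j
rightBranch-cong f c≡c′ i (suc j) size = c≡c′ i j (subst (_≤ f) (+-suc i j) size)
rightBranch-cong f c≡c′ zero zero _ = refl
rightBranch-cong f c≡c′ (suc i) zero _ = refl

CountsTreesBelow : ℕ → (ℕ → ℕ → ℕ) → Set
CountsTreesBelow f c = ∀ A B → Descending A → Descending B → length A + length B < f →
  Trees (sort A) (sort B) ↔ Fin (c (length A) (length B))

sort-∷≢sort-[] : ∀ {x xs} → sort (x ∷ xs) ≢ sort []
sort-∷≢sort-[] e = ¬x∷xs↭[] (sort-≡⇒↭ e)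

LeftBranches↔Fin : ∀ {f c} → CountsTreesBelow f c → ∀ A B → Descending A → Descending B →
  length A + length B ≤ f → LeftBranches A B ↔ Fin (leftBranch c (length A) (length B))
LeftBranches↔Fin _ [] [] _ _ _ =
  mk↔ₛ′ (λ _ → fzero) (λ _ → nothing , refl , refl , tt) (λ { fzero → refl ; (fsuc ()) })
    λ { (nothing , _) → Σ-≡-irrelevant LeftBranchLabelledBy-irrelevant refl
      ; (just _ , e , _) → ⊥-elim (sort-∷≢sort-[] e) }
LeftBranches↔Fin _ [] (_ ∷ _) _ _ _ = mk↔ₛ′ (⊥-elim ∘ empty) (λ ()) (λ ()) (⊥-elim ∘ empty)
  where
    empty : LeftBranches [] (_ ∷ _) → ⊥
    empty (nothing , _ , e , _) = sort-∷≢sort-[] (sym e)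
    empty (just _ , e , _) = sort-∷≢sort-[] e
LeftBranches↔Fin counts (k ∷ A) B (k>A ∷ A↘) B↘ size = ↔-trans root (counts A B A↘ B↘ size)
  where
    -- By the ancestor condition the left child carries the largest left label, which is k.
    root : LeftBranches (k ∷ A) B ↔ Trees (sort A) (sort B)
    root = mk↔ₛ′
      (λ { (nothing , e , _) → ⊥-elim (sort-∷≢sort-[] (sym e))
         ; (just (_ , t) , e , e′ , (t<k , dec)) → t , ↭⇒sort-≡ (proj₂ (↭-head-max (sort-≡⇒↭ e) t<k k>A)) , e′ , dec })
      (λ (t , e , e′ , dec) →
         just (k , t) , ↭⇒sort-≡ (prep k (sort-≡⇒↭ e)) , e′ , (All-resp-↭ (↭-sym (sort-≡⇒↭ e)) k>A , dec))
      (λ _ → Σ-≡-irrelevant LabelledBy-irrelevant refl)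
      λ { (nothing , e , _) → ⊥-elim (sort-∷≢sort-[] (sym e))
        ; (just (_ , t) , e , _ , (t<k , _)) →
            Σ-≡-irrelevant LeftBranchLabelledBy-irrelevant (cong (λ k′ → just (k′ , t)) (sym (proj₁ (↭-head-max (sort-≡⇒↭ e) t<k k>A)))) }

RightBranches↔Fin : ∀ {f c} → CountsTreesBelow f c → ∀ A B → Descending A → Descending B →
  length A + length B ≤ f → RightBranches A B ↔ Fin (rightBranch c (length A) (length B))
RightBranches↔Fin _ [] [] _ _ _ =
  mk↔ₛ′ (λ _ → fzero) (λ _ → nothing , refl , refl , tt) (λ { fzero → refl ; (fsuc ()) })
    λ { (nothing , _) → Σ-≡-irrelevant RightBranchLabelledBy-irrelevant refl
      ; (just _ , _ , e , _) → ⊥-elim (sort-∷≢sort-[] e) }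
RightBranches↔Fin _ (_ ∷ _) [] _ _ _ = mk↔ₛ′ (⊥-elim ∘ empty) (λ ()) (λ ()) (⊥-elim ∘ empty)
  where
    empty : RightBranches (_ ∷ _) [] → ⊥
    empty (nothing , e , _) = sort-∷≢sort-[] (sym e)
    empty (just _ , _ , e , _) = sort-∷≢sort-[] e
RightBranches↔Fin {f} counts A (k ∷ B) A↘ (k>B ∷ B↘) size =
  ↔-trans root (counts A B A↘ B↘ (subst (_≤ f) (+-suc (length A) (length B)) size))
  where
    root : RightBranches A (k ∷ B) ↔ Trees (sort A) (sort B)
    root = mk↔ₛ′
      (λ { (nothing , _ , e , _) → ⊥-elim (sort-∷≢sort-[] (sym e))
         ; (just (_ , t) , e , e′ , (t<k , dec)) → t , e , ↭⇒sort-≡ (proj₂ (↭-head-max (sort-≡⇒↭ e′) t<k k>B)) , dec })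
      (λ (t , e , e′ , dec) →
         just (k , t) , e , ↭⇒sort-≡ (prep k (sort-≡⇒↭ e′)) , (All-resp-↭ (↭-sym (sort-≡⇒↭ e′)) k>B , dec))
      (λ _ → Σ-≡-irrelevant LabelledBy-irrelevant refl)
      λ { (nothing , _ , e , _) → ⊥-elim (sort-∷≢sort-[] (sym e))
        ; (just (_ , t) , _ , e′ , (t<k , _)) →
            Σ-≡-irrelevant RightBranchLabelledBy-irrelevant (cong (λ k′ → just (k′ , t)) (sym (proj₁ (↭-head-max (sort-≡⇒↭ e′) t<k k>B)))) }

-- The recursion is not structural in (m, n), so it is run on a fuel parameter bounding m + n.
treeCount : ℕ → ℕ → ℕ → ℕ
treeCount zero m n = 0
treeCount (suc f) = labelledProduct (leftBranch (treeCount f)) (rightBranch (treeCount f))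

Trees↔Fin-treeCount : ∀ f → CountsTreesBelow f (treeCount f)
Trees↔Fin-treeCount zero _ _ _ _ ()
Trees↔Fin-treeCount (suc f) D E D↘ E↘ size = ↔-trans (Trees↔Splitting D E D↘ E↘)
  (Σ-subsets↔Fin D _ _ λ v → Σ-subsets↔Fin E _ _ λ w → ↔-trans
    (LeftBranches↔Fin (Trees↔Fin-treeCount f) (selected D v) (selected E w)
       (Descending-selected D v D↘) (Descending-selected E w E↘)
       (≤-trans (+-mono-≤ (length-selected≤ D v) (length-selected≤ E w)) (≤-pred size))
     ×-↔
     RightBranches↔Fin (Trees↔Fin-treeCount f) (unselected D v) (unselected E w)
       (Descending-unselected D v D↘) (Descending-unselected E w E↘)
       (≤-trans (+-mono-≤ (length-unselected≤ D v) (length-unselected≤ E w)) (≤-pred size)))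
    (↔-sym *↔×))

downFrom : ℕ → List ℕ
downFrom = applyDownFrom suc

All-downFrom< : ∀ m → All (_< suc m) (downFrom m)
All-downFrom< zero = []
All-downFrom< (suc m) = ≤-refl ∷ All.map m≤n⇒m≤1+n (All-downFrom< m)

Descending-downFrom : ∀ m → Descending (downFrom m)
Descending-downFrom zero = []
Descending-downFrom (suc m) = All-downFrom< m ∷ Descending-downFrom m

downFrom↭applyUpTo : ∀ m → downFrom m ↭ applyUpTo suc m
downFrom↭applyUpTo zero = ↭-refl
downFrom↭applyUpTo (suc m) = ↭-trans (prep (suc m) (downFrom↭applyUpTo m))
  (subst (suc m ∷ applyUpTo suc m ↭_) (applyUpTo-∷ʳ suc m) (∷↭∷ʳ (suc m) (applyUpTo suc m)))

Sorted-applyUpTo : ∀ (h : ℕ → ℕ) → (∀ i → h i ≤ h (suc i)) → ∀ m → Sorted ≤-totalOrder (applyUpTo h m)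
Sorted-applyUpTo h h-mono zero = []
Sorted-applyUpTo h h-mono (suc zero) = [-]
Sorted-applyUpTo h h-mono (suc (suc m)) = h-mono 0 ∷ Sorted-applyUpTo (h ∘ suc) (h-mono ∘ suc) (suc m)

sort-downFrom : ∀ m → sort (downFrom m) ≡ oneTo m
sort-downFrom m = trans
  (sorted-↭⇒≡ (sort-↗ (downFrom m)) (Sorted-applyUpTo suc (n≤1+n ∘ suc) m)
    (↭-trans (sort-↭ (downFrom m)) (downFrom↭applyUpTo m)))
  (sym (map-applyUpTo (λ i → i) suc m))

NAT↔Fin-treeCount : ∀ f m n → m + n < f → NAT m n ↔ Fin (treeCount f m n)
NAT↔Fin-treeCount f m n size =
  subst₂ (λ S T → Trees S T ↔ Fin (treeCount f m n)) (sort-downFrom m) (sort-downFrom n)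
    (subst₂ (λ i j → Trees (sort (downFrom m)) (sort (downFrom n)) ↔ Fin (treeCount f i j)) |m| |n|
      (Trees↔Fin-treeCount f (downFrom m) (downFrom n) (Descending-downFrom m) (Descending-downFrom n)
        (subst₂ (λ i j → i + j < f) (sym |m|) (sym |n|) size)))
  where
    |m| : length (downFrom m) ≡ m
    |m| = length-applyDownFrom suc m
    |n| : length (downFrom n) ≡ n
    |n| = length-applyDownFrom suc n

-- Binomial sums

sumToℕ : ℕ → (ℕ → ℕ) → ℕ
sumToℕ zero f = f zero
sumToℕ (suc m) f = sumToℕ m f + f (suc m)

sumToℕ-cong : ∀ m {f g} → (∀ i → i ≤ m → f i ≡ g i) → sumToℕ m f ≡ sumToℕ m g
sumToℕ-cong zero f≡g = f≡g 0 z≤n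
sumToℕ-cong (suc m) f≡g = cong₂ _+_ (sumToℕ-cong m (λ i i≤m → f≡g i (m≤n⇒m≤1+n i≤m))) (f≡g (suc m) ≤-refl)

sumToℕ-suc : ∀ m f → sumToℕ (suc m) f ≡ f 0 + sumToℕ m (f ∘ suc)
sumToℕ-suc zero f = refl
sumToℕ-suc (suc m) f = begin
  sumToℕ (suc m) f + f (2 + m)             ≡⟨ cong (_+ f (2 + m)) (sumToℕ-suc m f) ⟩
  f 0 + sumToℕ m (f ∘ suc) + f (2 + m)     ≡⟨ +-assoc (f 0) _ _ ⟩
  f 0 + (sumToℕ m (f ∘ suc) + f (2 + m))   ∎

sumToℕ-+ : ∀ m f g → sumToℕ m (λ i → f i + g i) ≡ sumToℕ m f + sumToℕ m g
sumToℕ-+ zero f g = refl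
sumToℕ-+ (suc m) f g = begin
  sumToℕ m (λ i → f i + g i) + (f (suc m) + g (suc m))
    ≡⟨ cong (_+ (f (suc m) + g (suc m))) (sumToℕ-+ m f g) ⟩
  sumToℕ m f + sumToℕ m g + (f (suc m) + g (suc m))
    ≡⟨ +-interchange (sumToℕ m f) (sumToℕ m g) (f (suc m)) (g (suc m)) ⟩
  sumToℕ m f + f (suc m) + (sumToℕ m g + g (suc m)) ∎

sumToℕ-*ˡ : ∀ m c f → sumToℕ m (λ i → c * f i) ≡ c * sumToℕ m f
sumToℕ-*ˡ zero c f = refl
sumToℕ-*ˡ (suc m) c f =
  trans (cong (_+ c * f (suc m)) (sumToℕ-*ˡ m c f)) (sym (*-distribˡ-+ c (sumToℕ m f) (f (suc m))))

subsetSum≡∑C : ∀ m g → subsetSum m g ≡ sumToℕ m (λ i → (m C i) * g i (m ∸ i))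
subsetSum≡∑C zero g = sym (*-identityˡ (g 0 0))
subsetSum≡∑C (suc m) g = begin
  subsetSum m (λ i k → g (suc i) k) + subsetSum m (λ i k → g i (suc k))
    ≡⟨ cong₂ _+_ (subsetSum≡∑C m _) (subsetSum≡∑C m _) ⟩
  A + sumToℕ m (λ i → (m C i) * g i (suc (m ∸ i)))
    ≡⟨ cong (_+_ A) (sumToℕ-cong m λ i i≤m → cong (λ k → (m C i) * g i k) (sym (+-∸-assoc 1 i≤m))) ⟩
  A + sumToℕ m (λ i → (m C i) * t i)
    ≡⟨ cong (_+_ A) (sym (+-identityʳ _)) ⟩
  A + (sumToℕ m (λ i → (m C i) * t i) + 0)
    ≡⟨ cong (λ c → A + (sumToℕ m (λ i → (m C i) * t i) + c * t (suc m))) (sym (k>n⇒nCk≡0 (n<1+n m))) ⟩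
  A + sumToℕ (suc m) (λ i → (m C i) * t i)
    ≡⟨ cong (_+_ A) (sumToℕ-suc m _) ⟩
  A + ((m C 0) * t 0 + B)
    ≡⟨ x+[y+z]≡y+[x+z] A ((m C 0) * t 0) B ⟩
  (m C 0) * t 0 + (A + B)
    ≡⟨ cong (_+_ ((m C 0) * t 0)) (sym (sumToℕ-+ m _ _)) ⟩
  (m C 0) * t 0 + sumToℕ m (λ i → (m C i) * t (suc i) + (m C suc i) * t (suc i))
    ≡⟨ cong (_+_ ((m C 0) * t 0)) (sumToℕ-cong m λ i _ →
         trans (sym (*-distribʳ-+ (t (suc i)) (m C i) (m C suc i))) (cong (_* t (suc i)) (nCk+nC[k+1]≡[n+1]C[k+1] m i))) ⟩
  (m C 0) * t 0 + sumToℕ m (λ i → (suc m C suc i) * t (suc i))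
    ≡⟨ sym (sumToℕ-suc m (λ i → (suc m C i) * t i)) ⟩
  sumToℕ (suc m) (λ i → (suc m C i) * t i) ∎
  where
    t : ℕ → ℕ
    t i = g i (suc m ∸ i)
    A B : ℕ
    A = sumToℕ m (λ i → (m C i) * t (suc i))
    B = sumToℕ m (λ i → (m C suc i) * t (suc i))

labelledProduct≡∑∑C : ∀ P Q m n → labelledProduct P Q m n ≡
  sumToℕ m λ i → sumToℕ n λ j → (m C i) * ((n C j) * (P i j * Q (m ∸ i) (n ∸ j)))
labelledProduct≡∑∑C P Q m n = trans (subsetSum≡∑C m _) (sumToℕ-cong m λ i _ →
  trans (cong (_*_ (m C i)) (subsetSum≡∑C n _)) (sym (sumToℕ-*ˡ n (m C i) _)))

nCk*k![n∸k]!≡n! : ∀ {n k} → k ≤ n → (n C k) * (k ! * (n ∸ k) !) ≡ n !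
nCk*k![n∸k]!≡n! {n} {k} k≤n =
  trans (cong (_* (k ! * (n ∸ k) !)) (nCk≡n!/k![n-k]! k≤n)) (m/n*n≡m {{k !* (n ∸ k) !≢0}} (k![n∸k]!∣n! k≤n))

-- Exponential generating functions

toℚᵘ-/suc : ∀ p d → toℚᵘ (+ p / suc d) ≃ᵘ mkℚᵘ (+ p) d
toℚᵘ-/suc p d = toℚᵘ-fromℚᵘ (mkℚᵘ (+ p) d)

/-cross : ∀ p q {d e} .{{_ : NonZero d}} .{{_ : NonZero e}} → p * e ≡ q * d → + p / d ≡ + q / e
/-cross p q {suc d} {suc e} pe≡qd = toℚᵘ-injective
  (ℚᵘ.≃-trans (toℚᵘ-/suc p d) (ℚᵘ.≃-trans (*≡* ℤ-cross) (ℚᵘ.≃-sym (toℚᵘ-/suc q e))))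
  where
    ℤ-cross : + p ℤ.* + suc e ≡ + q ℤ.* + suc d
    ℤ-cross = trans (sym (pos-* p (suc e))) (trans (cong +_ pe≡qd) (pos-* q (suc d)))

/-*-/ : ∀ p q d e .{{_ : NonZero d}} .{{_ : NonZero e}} →
  (+ p / d) *ℚ (+ q / e) ≡ (+ (p * q) / (d * e)) {{m*n≢0 d e}}
/-*-/ p q (suc d) (suc e) = toℚᵘ-injective
  (ℚᵘ.≃-trans (toℚᵘ-homo-* (+ p / suc d) (+ q / suc e))
  (ℚᵘ.≃-trans (ℚᵘ.*-cong (toℚᵘ-/suc p d) (toℚᵘ-/suc q e))
  (ℚᵘ.≃-trans (ℚᵘ.≃-reflexive (cong (λ z → mkℚᵘ z _) (sym (pos-* p q)))) (ℚᵘ.≃-sym (toℚᵘ-/suc (p * q) _)))))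

/-+-/ : ∀ p q d .{{_ : NonZero d}} → (+ p / d) +ℚ (+ q / d) ≡ + (p + q) / d
/-+-/ p q (suc d) = trans (toℚᵘ-injective
  (ℚᵘ.≃-trans (toℚᵘ-homo-+ (+ p / suc d) (+ q / suc d))
  (ℚᵘ.≃-trans (ℚᵘ.+-cong (toℚᵘ-/suc p d) (toℚᵘ-/suc q d))
  (ℚᵘ.≃-trans (ℚᵘ.≃-reflexive (cong (λ z → mkℚᵘ z _) ℤ-sum)) (ℚᵘ.≃-sym (toℚᵘ-/suc (p * D + q * D) _))))))
  (/-cross (p * D + q * D) (p + q) {{m*n≢0 D D}} (common-denominator p q D))
  where
    D : ℕ
    D = suc d
    common-denominator : ∀ p q D → (p * D + q * D) * D ≡ (p + q) * (D * D)
    common-denominator = solve-∀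
    ℤ-sum : + p ℤ.* + D ℤ.+ + q ℤ.* + D ≡ + (p * D + q * D)
    ℤ-sum = trans (cong₂ ℤ._+_ (sym (pos-* p D)) (sym (pos-* q D))) (sym (pos-+ (p * D) (q * D)))

sumTo-cong : ∀ m {f g} → (∀ i → i ≤ m → f i ≡ g i) → sumTo m f ≡ sumTo m g
sumTo-cong zero f≡g = f≡g 0 z≤n
sumTo-cong (suc m) f≡g = cong₂ _+ℚ_ (sumTo-cong m (λ i i≤m → f≡g i (m≤n⇒m≤1+n i≤m))) (f≡g (suc m) ≤-refl)

sumTo-suc : ∀ m f → sumTo (suc m) f ≡ f 0 +ℚ sumTo m (f ∘ suc)
sumTo-suc zero f = refl
sumTo-suc (suc m) f =
  trans (cong (_+ℚ f (2 + m)) (sumTo-suc m f)) (ℚ.+-assoc (f 0) (sumTo m (f ∘ suc)) (f (2 + m)))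

sumTo-reverse : ∀ m f → sumTo m f ≡ sumTo m (λ i → f (m ∸ i))
sumTo-reverse zero f = refl
sumTo-reverse (suc m) f = begin
  sumTo m f +ℚ f (suc m)                     ≡⟨ cong (_+ℚ f (suc m)) (sumTo-reverse m f) ⟩
  sumTo m (λ i → f (m ∸ i)) +ℚ f (suc m)     ≡⟨ ℚ.+-comm _ (f (suc m)) ⟩
  f (suc m) +ℚ sumTo m (λ i → f (m ∸ i))     ≡⟨ sym (sumTo-suc m (λ i → f (suc m ∸ i))) ⟩
  sumTo (suc m) (λ i → f (suc m ∸ i))        ∎

sumTo-/ : ∀ m f d .{{_ : NonZero d}} → sumTo m (λ i → + f i / d) ≡ + sumToℕ m f / d
sumTo-/ zero f d = refl
sumTo-/ (suc m) f d = trans (cong (_+ℚ (+ f (suc m) / d)) (sumTo-/ m f d)) (/-+-/ (sumToℕ m f) (f (suc m)) d)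

_/[_!_!] : ℕ → ℕ → ℕ → ℚ
x /[ m ! n !] = (+ x / (m ! * n !)) {{m !* n !≢0}}

Gser-*-Gser : ∀ P Q {m n i j} → i ≤ m → j ≤ n →
  Gser P i j *ℚ Gser Q (m ∸ i) (n ∸ j) ≡ ((m C i) * ((n C j) * (P i j * Q (m ∸ i) (n ∸ j)))) /[ m ! n !]
Gser-*-Gser P Q {m} {n} {i} {j} i≤m j≤n = trans (/-*-/ (P i j) (Q k l) (i ! * j !) (k ! * l !))
  (/-cross (P i j * Q k l) ((m C i) * ((n C j) * (P i j * Q k l))) (begin
    P i j * Q k l * (m ! * n !)
      ≡⟨ cong₂ (λ x y → P i j * Q k l * (x * y)) (sym (nCk*k![n∸k]!≡n! i≤m)) (sym (nCk*k![n∸k]!≡n! j≤n)) ⟩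
    P i j * Q k l * ((m C i) * (i ! * k !) * ((n C j) * (j ! * l !)))
      ≡⟨ regroup (P i j) (Q k l) (m C i) (n C j) (i !) (k !) (j !) (l !) ⟩
    (m C i) * ((n C j) * (P i j * Q k l)) * (i ! * j ! * (k ! * l !)) ∎))
  where
    k l : ℕ
    k = m ∸ i
    l = n ∸ j
    instance
      i!j!≢0 : NonZero (i ! * j !)
      i!j!≢0 = i !* j !≢0
      k!l!≢0 : NonZero (k ! * l !)
      k!l!≢0 = k !* l !≢0
      m!n!≢0 : NonZero (m ! * n !)
      m!n!≢0 = m !* n !≢0
      i!j!k!l!≢0 : NonZero (i ! * j ! * (k ! * l !))
      i!j!k!l!≢0 = m*n≢0 (i ! * j !) (k ! * l !)
    regroup : ∀ p q a b i! k! j! l! →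
      p * q * (a * (i! * k!) * (b * (j! * l!))) ≡ a * (b * (p * q)) * (i! * j! * (k! * l!))
    regroup = solve-∀

Gser-⊗ : ∀ P Q m n → (Gser P ⊗ Gser Q) m n ≡ Gser (labelledProduct P Q) m n
Gser-⊗ P Q m n = begin
  sumTo m (λ i → sumTo n (λ j → Gser P i j *ℚ Gser Q (m ∸ i) (n ∸ j)))
    ≡⟨ sumTo-cong m (λ i i≤m → trans (sumTo-cong n λ j j≤n → Gser-*-Gser P Q i≤m j≤n) (sumTo-/ n _ _)) ⟩
  sumTo m (λ i → sumToℕ n (term i) /[ m ! n !])
    ≡⟨ sumTo-/ m _ _ ⟩
  sumToℕ m (λ i → sumToℕ n (term i)) /[ m ! n !]
    ≡⟨ cong (_/[ m ! n !]) (sym (labelledProduct≡∑∑C P Q m n)) ⟩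
  Gser (labelledProduct P Q) m n ∎
  where
    instance
      m!n!≢0 : NonZero (m ! * n !)
      m!n!≢0 = m !* n !≢0
    term : ℕ → ℕ → ℕ
    term i j = (m C i) * ((n C j) * (P i j * Q (m ∸ i) (n ∸ j)))

∫x-Gser : ∀ c m n → ∫x (Gser c) (suc m) n ≡ c m n /[ suc m ! n !]
∫x-Gser c m n = trans (/-*-/ (c m n) 1 (m ! * n !) (suc m)) (/-cross (c m n * 1) (c m n) (reorder (c m n) (suc m) (m !) (n !)))
  where
    instance
      m!n!≢0 : NonZero (m ! * n !)
      m!n!≢0 = m !* n !≢0
      [m+1]!n!≢0 : NonZero (suc m ! * n !)
      [m+1]!n!≢0 = suc m !* n !≢0
      m!n![m+1]≢0 : NonZero (m ! * n ! * suc m)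
      m!n![m+1]≢0 = m*n≢0 (m ! * n !) (suc m)
    reorder : ∀ x s m! n! → x * 1 * (s * m! * n!) ≡ x * (m! * n! * s)
    reorder = solve-∀

∫y-Gser : ∀ c m n → ∫y (Gser c) m (suc n) ≡ c m n /[ m ! suc n !]
∫y-Gser c m n = trans (/-*-/ (c m n) 1 (m ! * n !) (suc n)) (/-cross (c m n * 1) (c m n) (reorder (c m n) (suc n) (m !) (n !)))
  where
    instance
      m!n!≢0 : NonZero (m ! * n !)
      m!n!≢0 = m !* n !≢0
      m![n+1]!≢0 : NonZero (m ! * suc n !)
      m![n+1]!≢0 = m !* suc n !≢0
      m!n![n+1]≢0 : NonZero (m ! * n ! * suc n)
      m!n![n+1]≢0 = m*n≢0 (m ! * n !) (suc n)
    reorder : ∀ x s m! n! → x * 1 * (m! * (s * n!)) ≡ x * (m! * n! * s)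
    reorder = solve-∀

one⊕∫x-Gser : ∀ c m n → (one ⊕ ∫x (Gser c)) m n ≡ Gser (leftBranch c) m n
one⊕∫x-Gser c zero zero = refl
one⊕∫x-Gser c zero (suc n) = sym (0/n≡0 (1 * suc n !) {{0 !* suc n !≢0}})
one⊕∫x-Gser c (suc m) n = trans (ℚ.+-identityˡ _) (∫x-Gser c m n)

one⊕∫y-Gser : ∀ c m n → (one ⊕ ∫y (Gser c)) m n ≡ Gser (rightBranch c) m n
one⊕∫y-Gser c zero zero = refl
one⊕∫y-Gser c (suc m) zero = sym (0/n≡0 (suc m ! * 1) {{suc m !* 0 !≢0}})
one⊕∫y-Gser c zero (suc n) = trans (ℚ.+-identityˡ _) (∫y-Gser c 0 n)
one⊕∫y-Gser c (suc m) (suc n) = trans (ℚ.+-identityˡ _) (∫y-Gser c (suc m) n)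

fromℕℚ-*-1/≡1 : ∀ k → fromℕℚ (suc k) *ℚ (+ 1 / suc k) ≡ 1ℚ
fromℕℚ-*-1/≡1 k = trans (/-*-/ (suc k) 1 1 (suc k)) (/-cross (suc k * 1) 1 (cancel (suc k)))
  where
    cancel : ∀ s → s * 1 * 1 ≡ 1 * (1 * s)
    cancel = solve-∀

∂x-∫x : ∀ F m n → ∂x (∫x F) m n ≡ F m n
∂x-∫x F m n = begin
  fromℕℚ (suc m) *ℚ (F m n *ℚ (+ 1 / suc m)) ≡⟨ x*[y*z]≡y*[x*z] (fromℕℚ (suc m)) (F m n) _ ⟩
  F m n *ℚ (fromℕℚ (suc m) *ℚ (+ 1 / suc m)) ≡⟨ cong (F m n *ℚ_) (fromℕℚ-*-1/≡1 m) ⟩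
  F m n *ℚ 1ℚ                                ≡⟨ ℚ.*-identityʳ (F m n) ⟩
  F m n                                      ∎

∂y-∫y : ∀ F m n → ∂y (∫y F) m n ≡ F m n
∂y-∫y F m n = begin
  fromℕℚ (suc n) *ℚ (F m n *ℚ (+ 1 / suc n)) ≡⟨ x*[y*z]≡y*[x*z] (fromℕℚ (suc n)) (F m n) _ ⟩
  F m n *ℚ (fromℕℚ (suc n) *ℚ (+ 1 / suc n)) ≡⟨ cong (F m n *ℚ_) (fromℕℚ-*-1/≡1 n) ⟩
  F m n *ℚ 1ℚ                                ≡⟨ ℚ.*-identityʳ (F m n) ⟩
  F m n                                      ∎

∂y-∫x : ∀ F m n → ∂y (∫x F) m n ≡ ∫x (∂y F) m n
∂y-∫x F zero n = ℚ.*-zeroʳ (fromℕℚ (suc n))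
∂y-∫x F (suc m) n = sym (ℚ.*-assoc (fromℕℚ (suc n)) (F m (suc n)) _)

∫x-cong : ∀ {F H} → (∀ i j → F i j ≡ H i j) → ∀ m n → ∫x F m n ≡ ∫x H m n
∫x-cong F≡H zero n = refl
∫x-cong F≡H (suc m) n = cong (_*ℚ (+ 1 / suc m)) (F≡H m n)

∫y-cong : ∀ {F H} → (∀ i j → F i j ≡ H i j) → ∀ m n → ∫y F m n ≡ ∫y H m n
∫y-cong F≡H m zero = refl
∫y-cong F≡H m (suc n) = cong (_*ℚ (+ 1 / suc n)) (F≡H m n)

∂x-X⊕Y : ∀ m n → ∂x (X ⊕ Y) m n ≡ one m n
∂x-X⊕Y zero zero = refl
∂x-X⊕Y zero (suc n) = ℚ.*-zeroʳ (fromℕℚ 1)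
∂x-X⊕Y (suc m) n = ℚ.*-zeroʳ (fromℕℚ (2 + m))

∂y-X⊕Y : ∀ m n → ∂y (X ⊕ Y) m n ≡ one m n
∂y-X⊕Y zero zero = refl
∂y-X⊕Y zero (suc n) = ℚ.*-zeroʳ (fromℕℚ (2 + n))
∂y-X⊕Y (suc zero) n = ℚ.*-zeroʳ (fromℕℚ (suc n))
∂y-X⊕Y (suc (suc m)) n = ℚ.*-zeroʳ (fromℕℚ (suc n))

∂x-X⊕Y⊕∫x∫y : ∀ F m n → ∂x (X ⊕ Y ⊕ ∫x (∫y F)) m n ≡ (one ⊕ ∫y F) m n
∂x-X⊕Y⊕∫x∫y F m n = trans (ℚ.*-distribˡ-+ (fromℕℚ (suc m)) _ _)
  (cong₂ _+ℚ_ (∂x-X⊕Y m n) (∂x-∫x (∫y F) m n))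

∂y-X⊕Y⊕∫x∫y : ∀ F m n → ∂y (X ⊕ Y ⊕ ∫x (∫y F)) m n ≡ (one ⊕ ∫x F) m n
∂y-X⊕Y⊕∫x∫y F m n = trans (ℚ.*-distribˡ-+ (fromℕℚ (suc n)) _ _)
  (cong₂ _+ℚ_ (∂y-X⊕Y m n) (trans (∂y-∫x (∫y F) m n) (∫x-cong (∂y-∫y F) m n)))

⊗-cong : ∀ {F F′ H H′} → (∀ i j → F i j ≡ F′ i j) → (∀ i j → H i j ≡ H′ i j) →
  ∀ m n → (F ⊗ H) m n ≡ (F′ ⊗ H′) m n
⊗-cong F≡F′ H≡H′ m n = sumTo-cong m λ i _ → sumTo-cong n λ j _ → cong₂ _*ℚ_ (F≡F′ i j) (H≡H′ (m ∸ i) (n ∸ j))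

⊗-comm : ∀ F H m n → (F ⊗ H) m n ≡ (H ⊗ F) m n
⊗-comm F H m n = begin
  sumTo m (λ i → sumTo n λ j → F i j *ℚ H (m ∸ i) (n ∸ j))
    ≡⟨ sumTo-reverse m _ ⟩
  sumTo m (λ i → sumTo n λ j → F (m ∸ i) j *ℚ H (m ∸ (m ∸ i)) (n ∸ j))
    ≡⟨ sumTo-cong m (λ i i≤m → trans (sumTo-reverse n _) (sumTo-cong n λ j j≤n → begin
         F (m ∸ i) (n ∸ j) *ℚ H (m ∸ (m ∸ i)) (n ∸ (n ∸ j))
           ≡⟨ cong₂ (λ i′ j′ → F (m ∸ i) (n ∸ j) *ℚ H i′ j′) (m∸[m∸n]≡n i≤m) (m∸[m∸n]≡n j≤n) ⟩
         F (m ∸ i) (n ∸ j) *ℚ H i j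
           ≡⟨ ℚ.*-comm (F (m ∸ i) (n ∸ j)) (H i j) ⟩
         H i j *ℚ F (m ∸ i) (n ∸ j) ∎)) ⟩
  sumTo m (λ i → sumTo n λ j → H i j *ℚ F (m ∸ i) (n ∸ j)) ∎

module _ (a : ℕ → ℕ → ℕ) (a-counts : ∀ m n → NAT m n ↔ Fin (a m n)) where

  a≡treeCount : ∀ f m n → m + n < f → a m n ≡ treeCount f m n
  a≡treeCount f m n size = ↔⇒≡ (↔-trans (↔-sym (a-counts m n)) (NAT↔Fin-treeCount f m n size))

  count-recurrence : ∀ m n → a m n ≡ labelledProduct (leftBranch a) (rightBranch a) m n
  count-recurrence m n = trans (a≡treeCount (suc (m + n)) m n ≤-refl)
    (subsetSum-cong m λ i k i+k≡m → subsetSum-cong n λ j l j+l≡n → cong₂ _*_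
      (leftBranch-cong (m + n) (λ i′ j′ → sym ∘′ a≡treeCount (m + n) i′ j′) i j
        (+-mono-≤ (subst (i ≤_) i+k≡m (m≤m+n i k)) (subst (j ≤_) j+l≡n (m≤m+n j l))))
      (rightBranch-cong (m + n) (λ i′ j′ → sym ∘′ a≡treeCount (m + n) i′ j′) k l
        (+-mono-≤ (subst (k ≤_) i+k≡m (m≤n+m k i)) (subst (l ≤_) j+l≡n (m≤n+m l j)))))

  G-equation : ∀ m n → Gser a m n ≡ ((one ⊕ ∫x (Gser a)) ⊗ (one ⊕ ∫y (Gser a))) m n
  G-equation m n = begin
    Gser a m n                                          ≡⟨ cong (_/[ m ! n !]) (count-recurrence m n) ⟩
    Gser (labelledProduct (leftBranch a) (rightBranch a)) m n ≡⟨ sym (Gser-⊗ (leftBranch a) (rightBranch a) m n) ⟩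
    (Gser (leftBranch a) ⊗ Gser (rightBranch a)) m n   ≡⟨ sym (⊗-cong (one⊕∫x-Gser a) (one⊕∫y-Gser a) m n) ⟩
    ((one ⊕ ∫x (Gser a)) ⊗ (one ⊕ ∫y (Gser a))) m n    ∎

  L-equation : ∀ m n → Lser a m n ≡ (X ⊕ Y ⊕ ∫x (∫y (∂x (Lser a) ⊗ ∂y (Lser a)))) m n
  L-equation m n = cong (X m n +ℚ Y m n +ℚ_) (∫x-cong (∫y-cong G≡∂xL⊗∂yL) m n)
    where
      G≡∂xL⊗∂yL : ∀ i j → Gser a i j ≡ (∂x (Lser a) ⊗ ∂y (Lser a)) i j
      G≡∂xL⊗∂yL i j = begin
        Gser a i j                                         ≡⟨ G-equation i j ⟩
        ((one ⊕ ∫x (Gser a)) ⊗ (one ⊕ ∫y (Gser a))) i j    ≡⟨ ⊗-comm (one ⊕ ∫x (Gser a)) (one ⊕ ∫y (Gser a)) i j ⟩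
        ((one ⊕ ∫y (Gser a)) ⊗ (one ⊕ ∫x (Gser a))) i j    ≡⟨ sym (⊗-cong (∂x-X⊕Y⊕∫x∫y (Gser a)) (∂y-X⊕Y⊕∫x∫y (Gser a)) i j) ⟩
        (∂x (Lser a) ⊗ ∂y (Lser a)) i j                    ∎

mainTheorem1 : (a : ℕ → ℕ → ℕ) → (∀ m n → NAT m n ↔ Fin (a m n)) →
    (∀ m n → Lser a m n ≡ (X ⊕ Y ⊕ ∫x (∫y (∂x (Lser a) ⊗ ∂y (Lser a)))) m n)
    × (∀ m n → Gser a m n ≡ ((one ⊕ ∫x (Gser a)) ⊗ (one ⊕ ∫y (Gser a))) m n)
mainTheorem1 a a-counts = L-equation a a-counts , G-equation a a-counts
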